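{- Let $S$ be a set and $\to\subseteq S\times S$ a binary relation. For all $P,Q\subseteq S$, $F\subseteq S\times S$ and $c:S\to\mathbb{N}$: if $\mathrm{EnsuresN}_{\to}(P,Q,F,c)$ holds, then $\mathrm{Ensures}_{\to}(P,Q,F)$ holds.
   Context: For $n\in\mathbb{N}$, $\to^n$ denotes the $n$-fold composition of $\to$, with $\to^0$ the identity relation on $S$. For $Q\subseteq S$, $\mathrm{Ev}_{\to}(Q)\subseteq S$ is the least set closed under: (1) if $s\in Q$ then $s\in\mathrm{Ev}_{\to}(Q)$; (2) if there exists $s'$ with $s\to s'$ and every $s'$ with $s\to s'$ lies in $\mathrm{Ev}_{\to}(Q)$, then $s\in\mathrm{Ev}_{\to}(Q)$. For $n\in\mathbb{N}$, $\mathrm{EvN}_{\to}(n,Q)=\{s\in S\mid (\forall s'.\ s\to^n s'\Rightarrow s'\in Q)\wedge(\forall s'\,\forall l<n.\ s\to^l s'\Rightarrow\exists s''.\ s'\to s'')\}$. $\mathrm{Ensures}_{\to}(P,Q,F)$ means: for all $s\in P$, $s\in\mathrm{Ev}_{\to}(\{s'\mid s'\in Q\wedge (s,s')\in F\})$. $\mathrm{EnsuresN}_{\to}(P,Q,F,c)$ means: for all $s\in P$, $s\in\mathrm{EvN}_{\to}(c(s),\{s'\mid s'\in Q\wedge (s,s')\in F\})$. -}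

module Defs where

open import Level using (Level; _⊔_)
open import Data.Nat using (ℕ; zero; suc; _<_)
open import Data.Product using (Σ; ∃; _×_; _,_)
open import Relation.Binary.PropositionalEquality using (_≡_)

data Iter {a ℓ} {S : Set a} (R : S → S → Set ℓ) : ℕ → S → S → Set (a ⊔ ℓ) where
  iter-zero : ∀ {s} → Iter R zero s s
  iter-suc  : ∀ {n s s' s''} → R s s' → Iter R n s' s'' → Iter R (suc n) s s''

data Ev {a ℓ q} {S : Set a} (R : S → S → Set ℓ) (Q : S → Set q) : S → Set (a ⊔ ℓ ⊔ q) where
  ev-base : ∀ {s} → Q s → Ev R Q s
  ev-step : ∀ {s} → (∃ λ s' → R s s') → (∀ s' → R s s' → Ev R Q s') → Ev R Q s

EvN : ∀ {a ℓ q} {S : Set a} (R : S → S → Set ℓ) → ℕ → (S → Set q) → S → Set (a ⊔ ℓ ⊔ q)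
EvN R n Q s =
  (∀ s' → Iter R n s s' → Q s') ×
  (∀ s' l → l < n → Iter R l s s' → ∃ λ s'' → R s' s'')

QF : ∀ {a q f} {S : Set a} → (S → Set q) → (S → S → Set f) → S → S → Set (q ⊔ f)
QF Q F s s' = Q s' × F s s'

Ensures : ∀ {a ℓ p q f} {S : Set a} (R : S → S → Set ℓ) →
  (S → Set p) → (S → Set q) → (S → S → Set f) → Set (a ⊔ ℓ ⊔ p ⊔ q ⊔ f)
Ensures R P Q F = ∀ s → P s → Ev R (QF Q F s) s

EnsuresN : ∀ {a ℓ p q f} {S : Set a} (R : S → S → Set ℓ) →
  (S → Set p) → (S → Set q) → (S → S → Set f) → (S → ℕ) → Set (a ⊔ ℓ ⊔ p ⊔ q ⊔ f)
EnsuresN R P Q F c = ∀ s → P s → EvN R (c s) (QF Q F s) s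

{-# OPTIONS --safe #-}

-- Induction on the bound n: a state that surely reaches T within n steps
-- without deadlocking either lies in T (n = 0) or has a successor, and
-- every successor surely reaches T within n - 1 steps.

module Submission where

open import Defs
open import Level using (Level)
open import Data.Nat using (ℕ; zero; suc; s≤s; z≤n)
open import Data.Product using (∃; _,_)

module _ {a ℓ q} {S : Set a} {R : S → S → Set ℓ} {T : S → Set q} where

  EvN-suc⇒successor : ∀ {n s} → EvN R (suc n) T s → ∃ λ s' → R s s'
  EvN-suc⇒successor {s = s} (_ , live) = live s zero (s≤s z≤n) iter-zero

  EvN-suc-step : ∀ {n s s'} → EvN R (suc n) T s → R s s' → EvN R n T s'
  EvN-suc-step (reach , live) r =
      (λ s'' it → reach s'' (iter-suc r it))
    , (λ s'' l l<n it → live s'' (suc l) (s≤s l<n) (iter-suc r it))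

  EvN⇒Ev : ∀ n {s} → EvN R n T s → Ev R T s
  EvN⇒Ev zero    {s} (reach , _) = ev-base (reach s iter-zero)
  EvN⇒Ev (suc n)     evN         =
    ev-step (EvN-suc⇒successor evN)
            (λ s' r → EvN⇒Ev n (EvN-suc-step evN r))

theorem1 : ∀ {a ℓ p q f : Level} {S : Set a} (R : S → S → Set ℓ)
    (P : S → Set p) (Q : S → Set q) (F : S → S → Set f) (c : S → ℕ) →
    EnsuresN R P Q F c → Ensures R P Q F
theorem1 R P Q F c ensuresN s ps = EvN⇒Ev (c s) (ensuresN s ps)
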